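{- Let $V$ be a finite set of propositional variables, $\Pi := \{T,F\}^V$ the set of classical models, and let $\mu$ be a function assigning to every $\Sigma\subseteq\Pi$ a subset $\mu(\Sigma)\subseteq\Sigma$. Define $\beta \mid\!\sim \gamma$ iff $\mu(M(\beta))\subseteq M(\gamma)$. Then the following are equivalent: (a) $\mid\!\sim$ has interpolation in the sense that for all formulas $\phi,\psi$ with $\phi\mid\!\sim\psi$ there is a formula $\alpha$, all of whose propositional variables occur both in $\phi$ and in $\psi$ (the constants $\top,\bot$ being allowed), such that $\phi\mid\!\sim\alpha$ and $\alpha\vdash\psi$; (b) for all $\Sigma\subseteq\Pi$, $I(\Sigma)\subseteq I(\mu(\Sigma))$.
   Context: $M(\phi)$ is the set of models of $\phi$ and $\vdash$ is classical consequence. For $\Sigma\subseteq\Pi$, a variable $p\in V$ is irrelevant, $p\in I(\Sigma)$, iff for every $\sigma\in\Sigma$, changing the value of $\sigma$ at $p$ yields again an element of $\Sigma$; $R(\Sigma):=V-I(\Sigma)$. -}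

module Defs where

open import Data.Nat using (ℕ)
open import Data.Fin using (Fin)
open import Data.Bool using (Bool; true; false; not; _∧_; _∨_)
open import Data.Vec using (Vec; lookup; updateAt)
open import Data.Product using (_×_; ∃)
open import Data.Sum using (_⊎_)
open import Relation.Binary.PropositionalEquality using (_≡_)

Model : ℕ → Set
Model n = Vec Bool n

-- Subsets of Π, given by characteristic functions (Π is finite)
ModelSet : ℕ → Set
ModelSet n = Model n → Bool

_∈ₘ_ : ∀ {n} → Model n → ModelSet n → Set
σ ∈ₘ Σ = Σ σ ≡ true

_⊆ₘ_ : ∀ {n} → ModelSet n → ModelSet n → Set
Σ ⊆ₘ Σ' = ∀ σ → σ ∈ₘ Σ → σ ∈ₘ Σ'

data Form (n : ℕ) : Set where
  var  : Fin n → Form n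
  ⊤f   : Form n
  ⊥f   : Form n
  ¬f_  : Form n → Form n
  _∧f_ : Form n → Form n → Form n
  _∨f_ : Form n → Form n → Form n
  _⇒f_ : Form n → Form n → Form n

eval : ∀ {n} → Model n → Form n → Bool
eval σ (var p)   = lookup σ p
eval σ ⊤f        = true
eval σ ⊥f        = false
eval σ (¬f φ)    = not (eval σ φ)
eval σ (φ ∧f ψ)  = eval σ φ ∧ eval σ ψ
eval σ (φ ∨f ψ)  = eval σ φ ∨ eval σ ψ
eval σ (φ ⇒f ψ)  = not (eval σ φ) ∨ eval σ ψ

M : ∀ {n} → Form n → ModelSet n
M φ σ = eval σ φ

data Occurs {n : ℕ} (p : Fin n) : Form n → Set where
  here  : Occurs p (var p)
  ¬o    : ∀ {φ} → Occurs p φ → Occurs p (¬f φ)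
  ∧l    : ∀ {φ ψ} → Occurs p φ → Occurs p (φ ∧f ψ)
  ∧r    : ∀ {φ ψ} → Occurs p ψ → Occurs p (φ ∧f ψ)
  ∨l    : ∀ {φ ψ} → Occurs p φ → Occurs p (φ ∨f ψ)
  ∨r    : ∀ {φ ψ} → Occurs p ψ → Occurs p (φ ∨f ψ)
  ⇒l    : ∀ {φ ψ} → Occurs p φ → Occurs p (φ ⇒f ψ)
  ⇒r    : ∀ {φ ψ} → Occurs p ψ → Occurs p (φ ⇒f ψ)

-- classical consequence (semantic; equivalent to derivability by completeness)
_⊢_ : ∀ {n} → Form n → Form n → Set
φ ⊢ ψ = M φ ⊆ₘ M ψ

-- a choice function μ : 𝒫(Π) → 𝒫(Π) with μ(Σ) ⊆ Σ; since subsets are represented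
-- by characteristic functions, μ is required to respect extensional equality of sets
record Choice (n : ℕ) : Set where
  field
    μ      : ModelSet n → ModelSet n
    μ-ext  : ∀ Σ Σ' → (∀ σ → Σ σ ≡ Σ' σ) → ∀ σ → μ Σ σ ≡ μ Σ' σ
    μ-sub  : ∀ Σ → μ Σ ⊆ₘ Σ

_|∼⟨_⟩_ : ∀ {n} → Form n → Choice n → Form n → Set
β |∼⟨ c ⟩ γ = Choice.μ c (M β) ⊆ₘ M γ

Irrelevant : ∀ {n} → ModelSet n → Fin n → Set
Irrelevant Σ p = ∀ σ → σ ∈ₘ Σ → updateAt σ p not ∈ₘ Σ

Interpolation : ∀ {n} → Choice n → Set
Interpolation {n} c = ∀ (φ ψ : Form n) → φ |∼⟨ c ⟩ ψ →
  ∃ λ (α : Form n) →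
    (∀ p → Occurs p α → Occurs p φ × Occurs p ψ) × (φ |∼⟨ c ⟩ α) × (α ⊢ ψ)

IrrPreserved : ∀ {n} → Choice n → Set
IrrPreserved {n} c = ∀ (Σ : ModelSet n) (p : Fin n) →
  Irrelevant Σ p → Irrelevant (Choice.μ c Σ) p

module Submission where

open import Defs
open import Data.Nat using (ℕ; zero; suc)
open import Data.Fin using (Fin; zero; suc; _≟_)
open import Data.Bool using (Bool; true; false; not; _∧_; _∨_; if_then_else_)
open import Data.Bool.Properties using (∧-conicalˡ; ∧-conicalʳ)
open import Data.Vec using (Vec; []; _∷_; lookup; updateAt; tabulate)
open import Data.Vec.Properties using (lookup∘updateAt′; lookup∘tabulate)
open import Data.Product using (_×_; _,_; ∃)
open import Data.Sum using (_⊎_; inj₁; inj₂; [_,_])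
open import Data.Unit using (⊤; tt)
open import Data.Empty using (⊥-elim)
open import Relation.Nullary using (Dec; yes; no; ¬_; does)
open import Relation.Nullary.Decidable using (map′; _⊎-dec_; _×-dec_; ¬?; decidable-stable)
open import Relation.Unary using (Decidable)
open import Relation.Binary.PropositionalEquality using (_≡_; _≢_; refl; sym; trans; cong; cong₂)
open import Function using (_∘_)

-- Everything rests on three semantic facts about the finite model space {T,F}^n:
--   * coincidence: the truth value of φ depends only on the variables of φ, so
--     a variable absent from φ is irrelevant for M(φ);
--   * closure: a set Y containing τ contains every σ that differs from τ only at
--     variables irrelevant for Y;
--   * definability: for a decidable set S of variables and any set X of models,
--     the S-cylinder of X (models agreeing on S with some member of X) is M of a
--     formula whose variables all lie in S.
-- (b ⇒ a): the interpolant of φ |∼ ψ is the cylinder of μ(M φ) over the common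
--   variables of φ and ψ.
-- (a ⇒ b): if p is irrelevant for Σ, then Σ and μ(Σ) are defined by formulas
--   φ (without p) and ψ; an interpolant of φ |∼ ψ avoids p, so μ(Σ) is closed
--   under flipping p.

Agree : ∀ {n} → (Fin n → Set) → Model n → Model n → Set
Agree S σ τ = ∀ i → S i → lookup σ i ≡ lookup τ i

-- Sets of models given as characteristic functions are equal once they are
-- mutually included; this is the form in which μ-ext consumes set equality.
⊆-antisym : ∀ {n} {X Y : ModelSet n} → X ⊆ₘ Y → Y ⊆ₘ X → ∀ σ → X σ ≡ Y σ
⊆-antisym {X = X} {Y} X⊆Y Y⊆X σ with X σ in eqX | Y σ in eqY
... | true  | true  = refl
... | false | false = refl
... | true  | false = sym (trans (sym eqY) (X⊆Y σ eqX))
... | false | true  = trans (sym eqX) (Y⊆X σ eqY)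

∨-true-split : ∀ a b → a ∨ b ≡ true → a ≡ true ⊎ b ≡ true
∨-true-split true  _ _   = inj₁ refl
∨-true-split false _ b≡t = inj₂ b≡t

∨-true-introˡ : ∀ a b → a ≡ true → a ∨ b ≡ true
∨-true-introˡ true _ _ = refl

∨-true-introʳ : ∀ a b → b ≡ true → a ∨ b ≡ true
∨-true-introʳ true  _ _   = refl
∨-true-introʳ false _ b≡t = b≡t

irrelevant-closure : ∀ {k} (Y : ModelSet k) (σ τ : Model k) →
  (∀ i → lookup σ i ≢ lookup τ i → Irrelevant Y i) → τ ∈ₘ Y → σ ∈ₘ Y
irrelevant-closure Y [] [] _ τ∈Y = τ∈Y
irrelevant-closure Y (a ∷ σ) (b ∷ τ) irr τ∈Y =
  irrelevant-closure (λ v → Y (a ∷ v)) σ τ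
    (λ i differ v → irr (suc i) differ (a ∷ v)) (fix-head a b (irr zero) τ∈Y)
  where
  fix-head : ∀ a b → (a ≢ b → Irrelevant Y zero) → (b ∷ τ) ∈ₘ Y → (a ∷ τ) ∈ₘ Y
  fix-head true  true  _    y = y
  fix-head false false _    y = y
  fix-head true  false irr₀ y = irr₀ (λ ()) (false ∷ τ) y
  fix-head false true  irr₀ y = irr₀ (λ ()) (true ∷ τ) y

splice : ∀ {k} {S : Fin k → Set} → Decidable S → Model k → Model k → Model k
splice S? τ σ = tabulate λ i → if does (S? i) then lookup τ i else lookup σ i

splice-inside : ∀ {k} {S : Fin k → Set} (S? : Decidable S) τ σ i →
  S i → lookup (splice S? τ σ) i ≡ lookup τ i
splice-inside S? τ σ i s
  rewrite lookup∘tabulate (λ j → if does (S? j) then lookup τ j else lookup σ j) i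
  with S? i
... | yes _ = refl
... | no ¬s = ⊥-elim (¬s s)

splice-outside : ∀ {k} {S : Fin k → Set} (S? : Decidable S) τ σ i →
  ¬ S i → lookup (splice S? τ σ) i ≡ lookup σ i
splice-outside S? τ σ i ¬s
  rewrite lookup∘tabulate (λ j → if does (S? j) then lookup τ j else lookup σ j) i
  with S? i
... | yes s = ⊥-elim (¬s s)
... | no _  = refl

module _ {n : ℕ} where

  occurs? : (p : Fin n) (φ : Form n) → Dec (Occurs p φ)
  occurs? p (var q)  = map′ (λ { refl → here }) (λ { here → refl }) (p ≟ q)
  occurs? p ⊤f       = no λ ()
  occurs? p ⊥f       = no λ ()
  occurs? p (¬f φ)   = map′ ¬o (λ { (¬o o) → o }) (occurs? p φ)
  occurs? p (φ ∧f ψ) = map′ [ ∧l , ∧r ] (λ { (∧l o) → inj₁ o ; (∧r o) → inj₂ o })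
                         (occurs? p φ ⊎-dec occurs? p ψ)
  occurs? p (φ ∨f ψ) = map′ [ ∨l , ∨r ] (λ { (∨l o) → inj₁ o ; (∨r o) → inj₂ o })
                         (occurs? p φ ⊎-dec occurs? p ψ)
  occurs? p (φ ⇒f ψ) = map′ [ ⇒l , ⇒r ] (λ { (⇒l o) → inj₁ o ; (⇒r o) → inj₂ o })
                         (occurs? p φ ⊎-dec occurs? p ψ)

  coincidence : ∀ (φ : Form n) {σ ρ} → Agree (λ i → Occurs i φ) σ ρ → eval σ φ ≡ eval ρ φ
  coincidence (var p)  agree = agree p here
  coincidence ⊤f       agree = refl
  coincidence ⊥f       agree = refl
  coincidence (¬f φ)   agree = cong not (coincidence φ (λ i → agree i ∘ ¬o))
  coincidence (φ ∧f ψ) agree =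
    cong₂ _∧_ (coincidence φ (λ i → agree i ∘ ∧l)) (coincidence ψ (λ i → agree i ∘ ∧r))
  coincidence (φ ∨f ψ) agree =
    cong₂ _∨_ (coincidence φ (λ i → agree i ∘ ∨l)) (coincidence ψ (λ i → agree i ∘ ∨r))
  coincidence (φ ⇒f ψ) agree =
    cong₂ (λ a b → not a ∨ b)
      (coincidence φ (λ i → agree i ∘ ⇒l)) (coincidence ψ (λ i → agree i ∘ ⇒r))

  absent-irrelevant : ∀ (φ : Form n) {p} → ¬ Occurs p φ → Irrelevant (M φ) p
  absent-irrelevant φ {p} p∉φ σ σ⊨φ =
    trans (coincidence φ (λ i i∈φ → lookup∘updateAt′ i p (λ { refl → p∉φ i∈φ }) σ)) σ⊨φ

  ⋁ : (k : ℕ) → (Vec Bool k → Form n) → Form n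
  ⋁ zero    f = f []
  ⋁ (suc k) f = ⋁ k (f ∘ (true ∷_)) ∨f ⋁ k (f ∘ (false ∷_))

  ⋁-sound : ∀ σ k f → σ ∈ₘ M (⋁ k f) → ∃ λ v → σ ∈ₘ M (f v)
  ⋁-sound σ zero f σ⊨ = [] , σ⊨
  ⋁-sound σ (suc k) f σ⊨ with ∨-true-split (eval σ (⋁ k (f ∘ (true ∷_)))) _ σ⊨
  ... | inj₁ σ⊨ₜ = let v , σ⊨v = ⋁-sound σ k _ σ⊨ₜ in true ∷ v , σ⊨v
  ... | inj₂ σ⊨f = let v , σ⊨v = ⋁-sound σ k _ σ⊨f in false ∷ v , σ⊨v

  ⋁-complete : ∀ σ k f v → σ ∈ₘ M (f v) → σ ∈ₘ M (⋁ k f)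
  ⋁-complete σ zero    f []          σ⊨ = σ⊨
  ⋁-complete σ (suc k) f (true ∷ v)  σ⊨ = ∨-true-introˡ _ _ (⋁-complete σ k _ v σ⊨)
  ⋁-complete σ (suc k) f (false ∷ v) σ⊨ =
    ∨-true-introʳ (eval σ (⋁ k (f ∘ (true ∷_)))) _ (⋁-complete σ k _ v σ⊨)

  ⋁-vars : ∀ {p} k f → Occurs p (⋁ k f) → ∃ λ v → Occurs p (f v)
  ⋁-vars zero    f o      = [] , o
  ⋁-vars (suc k) f (∨l o) = let v , o′ = ⋁-vars k _ o in true ∷ v , o′
  ⋁-vars (suc k) f (∨r o) = let v , o′ = ⋁-vars k _ o in false ∷ v , o′

  ⋀ : (k : ℕ) → (Fin k → Form n) → Form n
  ⋀ zero    f = ⊤f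
  ⋀ (suc k) f = f zero ∧f ⋀ k (f ∘ suc)

  ⋀-sound : ∀ σ k f → σ ∈ₘ M (⋀ k f) → ∀ i → σ ∈ₘ M (f i)
  ⋀-sound σ (suc k) f σ⊨ zero    = ∧-conicalˡ _ _ σ⊨
  ⋀-sound σ (suc k) f σ⊨ (suc i) = ⋀-sound σ k _ (∧-conicalʳ (eval σ (f zero)) _ σ⊨) i

  ⋀-complete : ∀ σ k f → (∀ i → σ ∈ₘ M (f i)) → σ ∈ₘ M (⋀ k f)
  ⋀-complete σ zero    f σ⊨ = refl
  ⋀-complete σ (suc k) f σ⊨ rewrite σ⊨ zero = ⋀-complete σ k _ (σ⊨ ∘ suc)

  ⋀-vars : ∀ {p} k f → Occurs p (⋀ k f) → ∃ λ i → Occurs p (f i)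
  ⋀-vars (suc k) f (∧l o) = zero , o
  ⋀-vars (suc k) f (∧r o) = let i , o′ = ⋀-vars k _ o in suc i , o′

  literal : Bool → Fin n → Form n
  literal true  i = var i
  literal false i = ¬f var i

  literal-sound : ∀ σ b i → σ ∈ₘ M (literal b i) → lookup σ i ≡ b
  literal-sound σ true  i σ⊨ = σ⊨
  literal-sound σ false i σ⊨ with lookup σ i
  ... | false = refl

  literal-complete : ∀ σ b i → lookup σ i ≡ b → σ ∈ₘ M (literal b i)
  literal-complete σ true  i σi≡b = σi≡b
  literal-complete σ false i σi≡b rewrite σi≡b = refl

  module _ {S : Fin n → Set} (S? : Decidable S) where

    cube : Model n → Form n
    cube τ = ⋀ n λ i → if does (S? i) then literal (lookup τ i) i else ⊤f

    cube-sound : ∀ σ τ → σ ∈ₘ M (cube τ) → Agree S σ τ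
    cube-sound σ τ σ⊨ i s with S? i | ⋀-sound σ n _ σ⊨ i
    ... | yes _ | σ⊨lit = literal-sound σ (lookup τ i) i σ⊨lit
    ... | no ¬s | _     = ⊥-elim (¬s s)

    cube-complete : ∀ σ τ → Agree S σ τ → σ ∈ₘ M (cube τ)
    cube-complete σ τ agree = ⋀-complete σ n _ holds
      where
      holds : ∀ i → σ ∈ₘ M (if does (S? i) then literal (lookup τ i) i else ⊤f)
      holds i with S? i
      ... | yes s = literal-complete σ (lookup τ i) i (agree i s)
      ... | no _  = refl

    cube-vars : ∀ {p} τ → Occurs p (cube τ) → S p
    cube-vars {p} τ o with ⋀-vars n _ o
    ... | i , o′ with S? i
    ... | yes s with lookup τ i | o′
    ...   | true  | here    = s
    ...   | false | ¬o here = s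

    cylinder : ModelSet n → Form n
    cylinder X = ⋁ n λ τ → if X τ then cube τ else ⊥f

    cylinder-sound : ∀ X σ → σ ∈ₘ M (cylinder X) → ∃ λ τ → τ ∈ₘ X × Agree S σ τ
    cylinder-sound X σ σ⊨ with ⋁-sound σ n _ σ⊨
    ... | τ , σ⊨τ with X τ in τ∈X
    ... | true = τ , τ∈X , cube-sound σ τ σ⊨τ

    cylinder-complete : ∀ X {σ τ} → τ ∈ₘ X → Agree S σ τ → σ ∈ₘ M (cylinder X)
    cylinder-complete X {σ} {τ} τ∈X agree = ⋁-complete σ n _ τ σ⊨τ
      where
      σ⊨τ : σ ∈ₘ M (if X τ then cube τ else ⊥f)
      σ⊨τ rewrite τ∈X = cube-complete σ τ agree

    cylinder-vars : ∀ X {p} → Occurs p (cylinder X) → S p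
    cylinder-vars X o with ⋁-vars n _ o
    ... | τ , o′ with X τ
    ... | true = cube-vars τ o′

    cylinder-exact : ∀ X → (∀ i → ¬ S i → Irrelevant X i) → M (cylinder X) ⊆ₘ X
    cylinder-exact X irr σ σ⊨ with cylinder-sound X σ σ⊨
    ... | τ , τ∈X , agree = irrelevant-closure X σ τ (λ i differ → irr i (differ ∘ agree i)) τ∈X

    cylinder-defines : ∀ X → (∀ i → ¬ S i → Irrelevant X i) → ∀ σ → M (cylinder X) σ ≡ X σ
    cylinder-defines X irr =
      ⊆-antisym (cylinder-exact X irr) (λ σ σ∈X → cylinder-complete X σ∈X (λ _ _ → refl))

module _ {n : ℕ} (c : Choice n) where
  open Choice c

  interpolation-from-preservation : IrrPreserved c → Interpolation c
  interpolation-from-preservation preserves φ ψ φ|∼ψ = α , α-vars , φ|∼α , α⊢ψ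
    where
    common? : Decidable (λ i → Occurs i φ × Occurs i ψ)
    common? i = occurs? i φ ×-dec occurs? i ψ

    α : Form n
    α = cylinder common? (μ (M φ))

    α-vars : ∀ p → Occurs p α → Occurs p φ × Occurs p ψ
    α-vars p = cylinder-vars common? (μ (M φ))

    φ|∼α : φ |∼⟨ c ⟩ α
    φ|∼α σ σ∈μ = cylinder-complete common? (μ (M φ)) σ∈μ (λ _ _ → refl)

    -- Given σ ⊨ α with witness τ ∈ μ(M φ), the model τ′ that copies τ on the
    -- variables of φ and σ elsewhere stays in μ(M φ) (only variables irrelevant
    -- for μ(M φ) changed) and agrees with σ on the variables of ψ.
    α⊢ψ : α ⊢ ψ
    α⊢ψ σ σ⊨α with cylinder-sound common? (μ (M φ)) σ σ⊨α
    ... | τ , τ∈μ , agree = trans (coincidence ψ agreeψ) (φ|∼ψ τ′ τ′∈μ)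
      where
      τ′ : Model n
      τ′ = splice (λ i → occurs? i φ) τ σ

      τ′∈μ : τ′ ∈ₘ μ (M φ)
      τ′∈μ = irrelevant-closure (μ (M φ)) τ′ τ
        (λ i differ → preserves (M φ) i
          (absent-irrelevant φ (differ ∘ splice-inside (λ j → occurs? j φ) τ σ i)))
        τ∈μ

      agreeψ : Agree (λ i → Occurs i ψ) σ τ′
      agreeψ i i∈ψ with occurs? i φ
      ... | yes i∈φ =
        trans (agree i (i∈φ , i∈ψ)) (sym (splice-inside (λ j → occurs? j φ) τ σ i i∈φ))
      ... | no  i∉φ = sym (splice-outside (λ j → occurs? j φ) τ σ i i∉φ)

  preservation-from-interpolation : Interpolation c → IrrPreserved c
  preservation-from-interpolation interpolate Σ p p-irr τ τ∈μΣ = flip-τ∈μΣ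
    where
    not-p? : Decidable (λ i → i ≢ p)
    not-p? i = ¬? (i ≟ p)

    everything? : Decidable (λ (_ : Fin n) → ⊤)
    everything? _ = yes tt

    φ ψ : Form n
    φ = cylinder not-p? Σ
    ψ = cylinder everything? (μ Σ)

    Mφ≡Σ : ∀ σ → M φ σ ≡ Σ σ
    Mφ≡Σ = cylinder-defines not-p? Σ
      (λ i i≡p → irrelevant-at-p (decidable-stable (i ≟ p) i≡p))
      where
      irrelevant-at-p : ∀ {i} → i ≡ p → Irrelevant Σ i
      irrelevant-at-p refl = p-irr

    μMφ≡μΣ : ∀ σ → μ (M φ) σ ≡ μ Σ σ
    μMφ≡μΣ = μ-ext (M φ) Σ Mφ≡Σ

    ψ-exact : M ψ ⊆ₘ μ Σ
    ψ-exact = cylinder-exact everything? (μ Σ) (λ i ¬⊤ → ⊥-elim (¬⊤ tt))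

    φ|∼ψ : φ |∼⟨ c ⟩ ψ
    φ|∼ψ σ σ∈μ = cylinder-complete everything? (μ Σ) (trans (sym (μMφ≡μΣ σ)) σ∈μ) (λ _ _ → refl)

    flip-τ∈μΣ : updateAt τ p not ∈ₘ μ Σ
    flip-τ∈μΣ with interpolate φ ψ φ|∼ψ
    ... | α , α-vars , φ|∼α , α⊢ψ = ψ-exact _ (α⊢ψ _ (absent-irrelevant α p∉α τ τ⊨α))
      where
      p∉α : ¬ Occurs p α
      p∉α p∈α with α-vars p p∈α
      ... | p∈φ , _ = cylinder-vars not-p? Σ p∈φ refl

      τ⊨α : τ ∈ₘ M α
      τ⊨α = φ|∼α τ (trans (μMφ≡μΣ τ) τ∈μΣ)

fact4p2 : (n : ℕ) (c : Choice n) →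
    (Interpolation c → IrrPreserved c) × (IrrPreserved c → Interpolation c)
fact4p2 n c = preservation-from-interpolation c , interpolation-from-preservation c
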